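{- Let $(L;\wedge,\vee,^{\Delta},^{\nabla},0,1)$ be a weakly dicomplemented lattice and $F$ a filter of $L$. If $F$ is a prime filter, then $F$ is a primary filter of $L$. Moreover, if $F$ is a prime S-filter, then $F$ is maximal in the set $SF(L)$ of S-filters of $L$, i.e. there is no S-filter $H$ of $L$ with $F\subsetneq H\subsetneq L$.
   Context: A weakly dicomplemented lattice (WDL) is an algebra $(L;\wedge,\vee,^{\Delta},^{\nabla},0,1)$ such that $(L;\wedge,\vee,0,1)$ is a bounded lattice and, for all $x,y\in L$: $x^{\Delta\Delta}\le x$; $x\le y\Rightarrow y^{\Delta}\le x^{\Delta}$; $(x\wedge y)\vee(x\wedge y^{\Delta})=x$; $x^{\nabla\nabla}\ge x$; $x\le y\Rightarrow y^{\nabla}\le x^{\nabla}$; $(x\vee y)\wedge(x\vee y^{\nabla})=x$. A filter of $L$ is a nonempty upward closed subset closed under $\wedge$. A filter $F$ is prime if $x\vee y\in F$ implies $x\in F$ or $y\in F$; it is primary if for every $x\in L$, $x\in F$ or $x^{\Delta}\in F$. With $x\,\overline{\sqcap}\,y=(x^{\Delta}\vee y^{\Delta})^{\Delta}$, an S-filter is a filter $F$ with $x\,\overline{\sqcap}\,y\in F$ whenever $x,y\in F$. -}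

module Defs where

open import Level using (Level; _⊔_; suc)
open import Algebra.Lattice.Bundles using (Lattice)
open import Data.Product using (Σ; _×_; _,_)
open import Data.Sum using (_⊎_)
open import Relation.Nullary using (¬_)

record WDL (c ℓ : Level) : Set (suc (c ⊔ ℓ)) where
  field
    lattice : Lattice c ℓ
  open Lattice lattice public
  _≤_ : Carrier → Carrier → Set ℓ
  x ≤ y = (x ∧ y) ≈ x
  field
    ⊥L : Carrier
    ⊤L : Carrier
    ⊥L-least    : ∀ x → ⊥L ≤ x
    ⊤L-greatest : ∀ x → x ≤ ⊤L
    _ᐞ : Carrier → Carrier
    _ᐁ : Carrier → Carrier
    ᐞ-cong : ∀ {x y} → x ≈ y → (x ᐞ) ≈ (y ᐞ)
    ᐁ-cong : ∀ {x y} → x ≈ y → (x ᐁ) ≈ (y ᐁ)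
    ᐞᐞ-≤     : ∀ x → ((x ᐞ) ᐞ) ≤ x
    ᐞ-antitone : ∀ {x y} → x ≤ y → (y ᐞ) ≤ (x ᐞ)
    ᐞ-split  : ∀ x y → ((x ∧ y) ∨ (x ∧ (y ᐞ))) ≈ x
    ᐁᐁ-≥     : ∀ x → x ≤ ((x ᐁ) ᐁ)
    ᐁ-antitone : ∀ {x y} → x ≤ y → (y ᐁ) ≤ (x ᐁ)
    ᐁ-split  : ∀ x y → ((x ∨ y) ∧ (x ∨ (y ᐁ))) ≈ x

module _ {c ℓ : Level} (L : WDL c ℓ) where
  open WDL L

  _⊓̄_ : Carrier → Carrier → Carrier
  x ⊓̄ y = ((x ᐞ) ∨ (y ᐞ)) ᐞ

  record IsFilter {p : Level} (F : Carrier → Set p) : Set (c ⊔ ℓ ⊔ p) where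
    field
      nonempty : Σ Carrier F
      up-closed : ∀ {x y} → F x → x ≤ y → F y
      ∧-closed  : ∀ {x y} → F x → F y → F (x ∧ y)

  IsPrime : {p : Level} → (Carrier → Set p) → Set (c ⊔ p)
  IsPrime F = ∀ x y → F (x ∨ y) → F x ⊎ F y

  IsPrimeFilter : {p : Level} → (Carrier → Set p) → Set (c ⊔ ℓ ⊔ p)
  IsPrimeFilter F = IsFilter F × IsPrime F

  IsPrimary : {p : Level} → (Carrier → Set p) → Set (c ⊔ p)
  IsPrimary F = ∀ x → F x ⊎ F (x ᐞ)

  IsPrimaryFilter : {p : Level} → (Carrier → Set p) → Set (c ⊔ ℓ ⊔ p)
  IsPrimaryFilter F = IsFilter F × IsPrimary F

  IsSFilter : {p : Level} → (Carrier → Set p) → Set (c ⊔ ℓ ⊔ p)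
  IsSFilter F = IsFilter F × (∀ {x y} → F x → F y → F (x ⊓̄ y))

  _⊊_ : {p q : Level} → (Carrier → Set p) → (Carrier → Set q) → Set (c ⊔ p ⊔ q)
  F ⊊ H = (∀ {x} → F x → H x) × Σ Carrier (λ x → H x × ¬ F x)

  IsProper : {p : Level} → (Carrier → Set p) → Set (c ⊔ p)
  IsProper H = Σ Carrier (λ x → ¬ H x)

  IsMaximalSFilter : {p : Level} → (Carrier → Set p) → Set (c ⊔ ℓ ⊔ suc p)
  IsMaximalSFilter {p} F =
    ¬ (Σ (Carrier → Set p) (λ H → IsSFilter H × (F ⊊ H) × IsProper H))

-- Taking x = 1 in the axiom (x ∧ y) ∨ (x ∧ yΔ) = x gives y ∨ yΔ = 1 for every y.
-- A prime filter contains 1 = x ∨ xΔ, hence x or xΔ: it is primary. If an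
-- S-filter H strictly contains a primary F, pick x ∈ H ∖ F; then xΔ ∈ F ⊆ H, so
-- H ∋ x ⊓̄ xΔ = (xΔ ∨ xΔΔ)Δ = 1Δ = 0ΔΔ ≤ 0 and H = L. So F itself need not be
-- an S-filter.
module Submission where

open import Defs
open import Level using (Level)
open import Data.Product using (_×_; _,_)
open import Data.Sum using (inj₁; inj₂)
open import Relation.Nullary using (¬_)
import Algebra.Lattice.Properties.Lattice as LatticeProperties
import Relation.Binary.Reasoning.Setoid as SetoidReasoning

module _ {c ℓ : Level} (L : WDL c ℓ) where
  open WDL L
  open LatticeProperties lattice using (∧-idem)
  open SetoidReasoning setoid

  ≈⇒≤ : ∀ {x y} → x ≈ y → x ≤ y
  ≈⇒≤ {x} x≈y = trans (∧-congˡ (sym x≈y)) (∧-idem x)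

  ≤-trans : ∀ {x y z} → x ≤ y → y ≤ z → x ≤ z
  ≤-trans {x} {y} {z} x≤y y≤z = begin
    x ∧ z        ≈⟨ ∧-congʳ x≤y ⟨
    (x ∧ y) ∧ z  ≈⟨ ∧-assoc x y z ⟩
    x ∧ (y ∧ z)  ≈⟨ ∧-congˡ y≤z ⟩
    x ∧ y        ≈⟨ x≤y ⟩
    x            ∎

  ∧-identityˡ-⊤ : ∀ x → (⊤L ∧ x) ≈ x
  ∧-identityˡ-⊤ x = trans (∧-comm ⊤L x) (⊤L-greatest x)

  ∨-identityˡ-⊥ : ∀ x → (⊥L ∨ x) ≈ x
  ∨-identityˡ-⊥ x = begin
    ⊥L ∨ x         ≈⟨ ∨-congʳ (⊥L-least x) ⟨
    (⊥L ∧ x) ∨ x   ≈⟨ ∨-comm (⊥L ∧ x) x ⟩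
    x ∨ (⊥L ∧ x)   ≈⟨ ∨-congˡ (∧-comm ⊥L x) ⟩
    x ∨ (x ∧ ⊥L)   ≈⟨ ∨-absorbs-∧ x ⊥L ⟩
    x              ∎

  ∨-ᐞ-complementʳ : ∀ x → (x ∨ (x ᐞ)) ≈ ⊤L
  ∨-ᐞ-complementʳ x = begin
    x ∨ (x ᐞ)                ≈⟨ ∨-cong (∧-identityˡ-⊤ x) (∧-identityˡ-⊤ (x ᐞ)) ⟨
    (⊤L ∧ x) ∨ (⊤L ∧ (x ᐞ))  ≈⟨ ᐞ-split ⊤L x ⟩
    ⊤L                       ∎

  ⊥ᐞ≈⊤ : (⊥L ᐞ) ≈ ⊤L
  ⊥ᐞ≈⊤ = trans (sym (∨-identityˡ-⊥ (⊥L ᐞ))) (∨-ᐞ-complementʳ ⊥L)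

  ⊤ᐞ≤⊥ : (⊤L ᐞ) ≤ ⊥L
  ⊤ᐞ≤⊥ = ≤-trans (≈⇒≤ (ᐞ-cong (sym ⊥ᐞ≈⊤))) (ᐞᐞ-≤ ⊥L)

  ⊓̄-ᐞ-complement≤⊥ : ∀ x → _⊓̄_ L x (x ᐞ) ≤ ⊥L
  ⊓̄-ᐞ-complement≤⊥ x = ≤-trans (≈⇒≤ (ᐞ-cong (∨-ᐞ-complementʳ (x ᐞ)))) ⊤ᐞ≤⊥

  module _ {q : Level} {G : Carrier → Set q} (isFilter : IsFilter L G) where
    open IsFilter isFilter

    ⊤∈filter : G ⊤L
    ⊤∈filter = let (x , Gx) = nonempty in up-closed Gx (⊤L-greatest x)

    ⊥∈filter⇒¬proper : G ⊥L → ¬ IsProper L G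
    ⊥∈filter⇒¬proper G⊥ (x , x∉G) = x∉G (up-closed G⊥ (⊥L-least x))

    prime⇒primary : IsPrime L G → IsPrimary L G
    prime⇒primary prime x =
      prime x (x ᐞ) (up-closed ⊤∈filter (≈⇒≤ (sym (∨-ᐞ-complementʳ x))))

  SFilter-∋-ᐞ-complement⇒¬proper : ∀ {q} {H : Carrier → Set q} → IsSFilter L H →
    ∀ {x} → H x → H (x ᐞ) → ¬ IsProper L H
  SFilter-∋-ᐞ-complement⇒¬proper (isFilter , ⊓̄-closed) Hx Hxᐞ =
    ⊥∈filter⇒¬proper isFilter
      (IsFilter.up-closed isFilter (⊓̄-closed Hx Hxᐞ) (⊓̄-ᐞ-complement≤⊥ _))

  primary⇒maximalSFilter : ∀ {p} {F : Carrier → Set p} → IsPrimary L F → IsMaximalSFilter L F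
  primary⇒maximalSFilter primary (H , isSFilter , (F⊆H , x , Hx , x∉F) , proper)
    with primary x
  ... | inj₁ Fx   = x∉F Fx
  ... | inj₂ Fxᐞ = SFilter-∋-ᐞ-complement⇒¬proper isSFilter Hx (F⊆H Fxᐞ) proper

proposition5p1 : ∀ {c ℓ p : Level} (L : WDL c ℓ) (F : WDL.Carrier L → Set p) →
    IsFilter L F →
    (IsPrime L F → IsPrimaryFilter L F) ×
    ((IsPrime L F × IsSFilter L F) → IsMaximalSFilter L F)
proposition5p1 L F isFilter =
  (λ prime → isFilter , prime⇒primary L isFilter prime) ,
  (λ (prime , _) → primary⇒maximalSFilter L (prime⇒primary L isFilter prime))
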